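{- Let $d\ge3$, $h\ge1$ and $0\le n\le h-1$. Then $$|G_{n+1}(d,h)/G_n(d,h)|=\begin{cases}\theta(d,h+1)^{d-1} & \text{if } n=0,\\ \theta(d,h+1-n)^{(d-2)d(d-1)^{n-1}} & \text{if } 1\le n\le h-1,\end{cases}$$ where $\theta(d,m)=\frac{(d-1)^m-1}{d-2}$.
   Context: Let $\mathcal{T}(d,h)$ be the ball of radius $h$ about a root vertex $0$ in the infinite $d$-regular tree (root has $d$ children, vertices at depth $1,\dots,h-1$ have $d-1$ children, depth-$h$ vertices are leaves; depth is the distance from $0$). Let $V$ be its vertex set, $p(i)$ the parent of $i\neq 0$, $C_i$ the children of $i$, $\{\mathbf{x}_i\}$ the standard basis of $\mathbb{Z}^V$, and $\delta_i = d\mathbf{x}_i - \mathbf{x}_{p(i)} - \sum_{j\in C_i}\mathbf{x}_j$ (omit $\mathbf{x}_{p(i)}$ for $i=0$; empty sum for leaves). The sandpile group is $G(d,h)=\mathbb{Z}^V/\sum_{i\in V}\mathbb{Z}\delta_i$, and $\bar{\mathbf{v}}$ denotes the image of $\mathbf{v}$. For $0\le m\le h$, $G_m(d,h)$ is the subgroup of $G(d,h)$ generated by $\{\bar{\mathbf{x}}_i: i\text{ at depth}\le m\}$. -}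

module Defs where

open import Data.Nat as ℕ using (ℕ; zero; suc; _≤_; _<_; _∸_; _^_)
import Data.Nat.Properties as ℕP
open import Data.Integer as ℤ using (ℤ; +_; 0ℤ; 1ℤ)
open import Data.List using (List; []; _∷_; length)
import Data.List.Properties as LP
open import Data.List.Relation.Unary.All using (All)
open import Data.Maybe using (Maybe; just; nothing)
import Data.Maybe as Maybe
import Data.Maybe.Properties as MP
open import Data.Fin using (Fin)
open import Data.Product using (Σ; _×_; _,_; proj₁; ∃)
open import Data.Sum using (_⊎_; inj₁; inj₂)
open import Data.Unit using (⊤)
open import Relation.Nullary using (Dec; yes; no)
open import Relation.Binary.PropositionalEquality using (_≡_)

-- Vertices of T(d,h): a vertex is the list of child-labels on the path
-- from the root 0 (= []).
Labels : ℕ → List ℕ → Set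
Labels d []       = ⊤
Labels d (c ∷ cs) = c < d × All (λ c′ → c′ < d ∸ 1) cs

Vertex : ℕ → ℕ → Set
Vertex d h = Σ (List ℕ) (λ p → length p ≤ h × Labels d p)

depth : ∀ {d h} → Vertex d h → ℕ
depth v = length (proj₁ v)

parent : List ℕ → Maybe (List ℕ)
parent []           = nothing
parent (x ∷ [])     = just []
parent (x ∷ y ∷ ys) = Maybe.map (x ∷_) (parent (y ∷ ys))

_≟L_ : (p q : List ℕ) → Dec (p ≡ q)
_≟L_ = LP.≡-dec ℕP._≟_

_≟M_ : (p q : Maybe (List ℕ)) → Dec (p ≡ q)
_≟M_ = MP.≡-dec _≟L_

ind : ∀ {P : Set} → Dec P → ℤ
ind (yes _) = 1ℤ
ind (no _)  = 0ℤ

ZVec : ℕ → ℕ → Set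
ZVec d h = Vertex d h → ℤ

basis : ∀ {d h} → Vertex d h → ZVec d h
basis i j = ind (proj₁ j ≟L proj₁ i)

-- δ_i = d x_i - x_{p(i)} - Σ_{j ∈ C_i} x_j
delta : ∀ {d h} → Vertex d h → ZVec d h
delta {d} i j =
  ((+ d) ℤ.* basis i j ℤ.- ind (parent (proj₁ i) ≟M just (proj₁ j)))
    ℤ.- ind (parent (proj₁ j) ≟M just (proj₁ i))

data Span {d h : ℕ} {I : Set} (g : I → ZVec d h) : ZVec d h → Set where
  gen  : ∀ i → Span g (g i)
  zer  : Span g (λ _ → 0ℤ)
  add  : ∀ {v w} → Span g v → Span g w → Span g (λ j → v j ℤ.+ w j)
  neg  : ∀ {v} → Span g v → Span g (λ j → ℤ.- v j)
  ext  : ∀ {v w} → (∀ j → v j ≡ w j) → Span g v → Span g w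

-- generators of the preimage of G_m(d,h) in Z^V:
-- x_i for depth i ≤ m, together with all δ_i
GenIdx : ℕ → ℕ → ℕ → Set
GenIdx d h m = Σ (Vertex d h) (λ i → depth i ≤ m) ⊎ Vertex d h

gensG : ∀ d h m → GenIdx d h m → ZVec d h
gensG d h m (inj₁ (i , _)) = basis i
gensG d h m (inj₂ i)       = delta i

InG : ∀ d h m → ZVec d h → Set
InG d h m v = Span (gensG d h m) v

_-ᵥ_ : ∀ {d h} → ZVec d h → ZVec d h → ZVec d h
(v -ᵥ w) j = v j ℤ.- w j

-- |G_{n+1}(d,h) / G_n(d,h)| = N : there are N elements of G_{n+1}
-- forming a complete irredundant system of representatives modulo G_n.
QuotientOrder : ℕ → ℕ → ℕ → ℕ → Set
QuotientOrder d h n N =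
  Σ (Fin N → ZVec d h) λ r →
    (∀ k → InG d h (suc n) (r k)) ×
    (∀ k l → InG d h n (r k -ᵥ r l) → k ≡ l) ×
    (∀ v → InG d h (suc n) v → ∃ λ k → InG d h n (v -ᵥ r k))

-- θ(d,m) = ((d-1)^m - 1)/(d-2), for d ≥ 3 (exact division); junk 0 otherwise
θ : ℕ → ℕ → ℕ
θ (suc (suc (suc k))) m = ((2 ℕ.+ k) ^ m ∸ 1) ℕ./ suc k
θ _ _ = 0

-- Fix a level n, put k = h − n − 1 and T = θ(d, k+2), and let m = d − 1. For a vertex p of
-- depth n+1, the weighted subtree sum ψ_p(w) = Σ_{q below p} θ(d, k+1−dist(p,q))·w(q) satisfies
-- ψ_p(δ_i) = T·[p = i] − θ(d,k+1)·[p(p) = i], because θ(s+1) = 1 + m·θ(s) makes the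
-- contributions of δ_i inside the subtree telescope; and ψ_p(x_j) = θ(d,k+1)·[p = j] for j at
-- depth n+1. Omit one child of every depth-n vertex and let E be the basis vectors of the
-- remaining depth-(n+1) vertices. Then E generates G_{n+1} modulo G_n (the sum of all children
-- of v is d·x_v − x_{p(v)} − δ_v), T·Eᵢ ∈ G_n (a θ-weighted sum of δ's over the subtree, plus
-- a multiple of x_{p(p)}), and for siblings p, p′ the functional −m(ψ_p − ψ_p′) is divisible by
-- T on G_n and, as m·θ(k+1) = T − 1, congruent to [p = j] on E_j. These form a dual basis
-- modulo T, so G_{n+1}/G_n ≅ (ℤ/T)^M with M the number of non-omitted children: d − 1 at the
-- root and (d − 2)·d·(d − 1)^{n−1} at level n ≥ 1.

module Submission where

open import Defs
open import Data.Nat.Base as Nat using (ℕ; zero; suc; _≤_; _<_; _∸_; _^_; z≤n; s≤s; NonZero)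
import Data.Nat.Properties as ℕP
import Data.Nat.Divisibility as ℕ∣
import Data.Nat.DivMod as ℕDivMod
import Data.Nat.Tactic.RingSolver as ℕSolver
open import Data.Integer.Base as Int using (ℤ; +_; -[1+_]; 0ℤ; 1ℤ; -1ℤ; ∣_∣)
import Data.Integer.Properties as ℤP
open import Data.Integer.Divisibility.Signed
  using (_∣_; divides; ∣m∣n⇒∣m+n; ∣m⇒∣-m; ∣m∣n⇒∣m-n; ∣n⇒∣m*n; ∣⇒∣ᵤ)
open import Data.Integer.DivMod using (_%ℕ_; _/ℕ_; a≡a%ℕn+[a/ℕn]*n; n%ℕd<d)
open import Data.Integer.Tactic.RingSolver using (solve-∀)
open import Algebra.Properties.Semiring.Sum ℤP.+-*-semiring
  using (sum-syntax; sum-cong-≗; sum-replicate-zero; sum-init-last; ∑-distrib-+; *-distribˡ-sum)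
open import Data.Fin.Base as Fin using (Fin; zero; suc; combine; toℕ; fromℕ<; finToFun; funToFin)
import Data.Fin.Properties as FinP
open import Data.Maybe.Base using (just; nothing; map)
import Data.Maybe.Properties as MaybeP
open import Data.List.Base using (List; []; _∷_; _++_; _∷ʳ_; length)
import Data.List.Properties as ListP
open import Data.List.Relation.Unary.All as All using (All; []; _∷_)
import Data.List.Relation.Unary.All.Properties as AllP
open import Data.Product using (∃; _×_; _,_; proj₁; proj₂)
open import Data.Sum.Base using (inj₁; inj₂)
open import Data.Unit.Base using (tt)
open import Data.Empty using (⊥-elim)
open import Function.Base using (_∘_)
open import Relation.Nullary using (Dec; yes; no; ¬_)
open import Relation.Nullary.Decidable using (_×-dec_)
open import Relation.Binary.Definitions using (DecidableEquality)
open import Relation.Binary.PropositionalEquality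

ind-yes : ∀ {P : Set} (p? : Dec P) → P → ind p? ≡ 1ℤ
ind-yes (yes _) _ = refl
ind-yes (no ¬p) p = ⊥-elim (¬p p)

ind-no : ∀ {P : Set} (p? : Dec P) → ¬ P → ind p? ≡ 0ℤ
ind-no (yes p) ¬p = ⊥-elim (¬p p)
ind-no (no _) _ = refl

ind-cong : ∀ {P Q : Set} (p? : Dec P) (q? : Dec Q) → (P → Q) → (Q → P) → ind p? ≡ ind q?
ind-cong (yes p) q? f g = sym (ind-yes q? (f p))
ind-cong (no ¬p) q? f g = sym (ind-no q? (¬p ∘ g))

ind-≟L-sym : ∀ p q → ind (p ≟L q) ≡ ind (q ≟L p)
ind-≟L-sym p q = ind-cong (p ≟L q) (q ≟L p) sym sym

ind-just : ∀ p q → ind (just p ≟M just q) ≡ ind (p ≟L q)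
ind-just p q = ind-cong (just p ≟M just q) (p ≟L q) MaybeP.just-injective (cong just)

module Integers where

  open Int using (_+_; _*_; _-_; -_)

  ∑-zero : ∀ {n} (f : Fin n → ℤ) → (∀ i → f i ≡ 0ℤ) → ∑[ i < n ] f i ≡ 0ℤ
  ∑-zero {n} f f≡0 = trans (sum-cong-≗ f≡0) (sum-replicate-zero n)

  ∑-neg : ∀ {n} (f : Fin n → ℤ) → ∑[ i < n ] (- f i) ≡ - ∑[ i < n ] f i
  ∑-neg f = begin
    ∑[ i < _ ] (- f i)        ≡⟨ sum-cong-≗ (λ i → sym (ℤP.-1*i≡-i (f i))) ⟩
    ∑[ i < _ ] (-1ℤ * f i)    ≡⟨ *-distribˡ-sum -1ℤ f ⟨
    -1ℤ * ∑[ i < _ ] f i      ≡⟨ ℤP.-1*i≡-i _ ⟩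
    - ∑[ i < _ ] f i          ∎
    where open ≡-Reasoning

  x≡[x+y]-y : ∀ x y → x ≡ (x + y) - y
  x≡[x+y]-y = solve-∀

  +suc* : ∀ n x → + suc n * x ≡ x + + n * x
  +suc* n x = trans (ℤP.*-distribʳ-+ x 1ℤ (+ n)) (cong (_+ + n * x) (ℤP.*-identityˡ x))

  ∑-const : ∀ n x → ∑[ i < n ] x ≡ + n * x
  ∑-const zero x = refl
  ∑-const (suc n) x = trans (cong (_+_ x) (∑-const n x)) (sym (+suc* n x))

  ∣-∑ : ∀ {t n} (f : Fin n → ℤ) → (∀ i → t ∣ f i) → t ∣ ∑[ i < n ] f i
  ∣-∑ {t} {zero} f t∣f = divides 0ℤ refl
  ∣-∑ {t} {suc n} f t∣f = ∣m∣n⇒∣m+n (t∣f zero) (∣-∑ (f ∘ suc) (t∣f ∘ suc))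

  ∑-select : ∀ {A : Set} (_≟_ : DecidableEquality A) {n} (g : Fin n → A) →
             (∀ {i j} → g i ≡ g j → i ≡ j) → (c : Fin n → ℤ) (j : Fin n) →
             ∑[ i < n ] (c i * ind (g i ≟ g j)) ≡ c j
  ∑-select _≟_ g g-inj c zero = begin
    c zero * ind (g zero ≟ g zero) + ∑[ i < _ ] (c (suc i) * ind (g (suc i) ≟ g zero))
      ≡⟨ cong₂ (λ x y → c zero * x + y) (ind-yes (g zero ≟ g zero) refl)
           (∑-zero _ λ i → trans (cong (c (suc i) *_) (ind-no _ (FinP.0≢1+n ∘ sym ∘ g-inj)))
                                 (ℤP.*-zeroʳ (c (suc i)))) ⟩
    c zero * 1ℤ + 0ℤ
      ≡⟨ trans (ℤP.+-identityʳ _) (ℤP.*-identityʳ _) ⟩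
    c zero ∎
    where open ≡-Reasoning
  ∑-select _≟_ g g-inj c (suc j) =
    trans (cong₂ _+_ (trans (cong (c zero *_) (ind-no _ (FinP.0≢1+n ∘ g-inj)))
                            (ℤP.*-zeroʳ (c zero)))
                     (∑-select _≟_ (g ∘ suc) (FinP.suc-injective ∘ g-inj) (c ∘ suc) j))
          (ℤP.+-identityˡ _)

  congruent-below⇒≡ : ∀ {t a b} → a < t → b < t → + t ∣ + a - + b → a ≡ b
  congruent-below⇒≡ {t} {a} {b} a<t b<t t∣a-b =
    ℤP.+-injective (ℤP.i-j≡0⇒i≡j (+ a) (+ b)
      (ℤP.∣i∣≡0⇒i≡0 (below-divisor ∣a-b∣<t (∣⇒∣ᵤ t∣a-b))))
    where
    ∣a-b∣<t : ∣ + a - + b ∣ < t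
    ∣a-b∣<t = ℕP.≤-<-trans (ℕP.≤-reflexive (cong ∣_∣ (ℤP.[+m]-[+n]≡m⊖n a b)))
                (ℕP.≤-<-trans (ℤP.∣m⊝n∣≤m⊔n a b) (ℕP.⊔-lub a<t b<t))
    below-divisor : ∀ {x} → x < t → t ℕ∣.∣ x → x ≡ 0
    below-divisor {zero} _ _ = refl
    below-divisor {suc x} x<t t∣x = ⊥-elim (ℕP.<⇒≱ x<t (ℕ∣.∣⇒≤ t∣x))

funToFin-cong : ∀ {m n} {f g : Fin m → Fin n} → (∀ i → f i ≡ g i) → funToFin f ≡ funToFin g
funToFin-cong {zero} f≗g = refl
funToFin-cong {suc m} f≗g = cong₂ combine (f≗g zero) (funToFin-cong (f≗g ∘ suc))

finToFun-injective : ∀ {m n} {k l : Fin (n ^ m)} → (∀ i → finToFun {n} {m} k i ≡ finToFun l i) → k ≡ l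
finToFun-injective {m} {n} {k} {l} eq =
  trans (sym (FinP.funToFin-finToFin {m} {n} k)) (trans (funToFin-cong eq) (FinP.funToFin-finToFin {m} {n} l))

remQuot-injective : ∀ {n} k {i j : Fin (n Nat.* k)} →
                    Fin.quotient {n} k i ≡ Fin.quotient {n} k j →
                    Fin.remainder {n} k i ≡ Fin.remainder {n} k j → i ≡ j
remQuot-injective {n} k {i} {j} q≡ r≡ =
  trans (sym (FinP.combine-remQuot {n} k i)) (trans (cong₂ combine q≡ r≡) (FinP.combine-remQuot {n} k j))

module Vectors (d h : ℕ) where

  open Int using (_+_; _*_; _-_; -_)
  open Integers

  V : Set
  V = ZVec d h

  infixl 6 _+ᵥ_
  infixl 7 _*ᵥ_

  _+ᵥ_ : V → V → V
  (v +ᵥ w) j = v j + w j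

  _*ᵥ_ : ℤ → V → V
  (c *ᵥ v) j = c * v j

  lincomb : ∀ {M} → (Fin M → ℤ) → (Fin M → V) → V
  lincomb {M} c E j = ∑[ i < M ] (c i * E i j)

  lincomb-+ : ∀ {M} (c c′ : Fin M → ℤ) E j →
              lincomb (λ i → c i + c′ i) E j ≡ lincomb c E j + lincomb c′ E j
  lincomb-+ c c′ E j =
    trans (sum-cong-≗ (λ i → ℤP.*-distribʳ-+ (E i j) (c i) (c′ i)))
          (∑-distrib-+ (λ i → c i * E i j) (λ i → c′ i * E i j))

  lincomb-neg : ∀ {M} (c : Fin M → ℤ) E j → lincomb (λ i → - c i) E j ≡ - lincomb c E j
  lincomb-neg c E j =
    trans (sum-cong-≗ (λ i → sym (ℤP.neg-distribˡ-* (c i) (E i j)))) (∑-neg (λ i → c i * E i j))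

  module _ {I : Set} {g : I → V} where

    span-+*ᵥ : ∀ n {v} → Span g v → Span g (+ n *ᵥ v)
    span-+*ᵥ zero s = zer
    span-+*ᵥ (suc n) {v} s = ext (λ j → sym (+suc* n (v j))) (add s (span-+*ᵥ n s))

    span-*ᵥ : ∀ c {v} → Span g v → Span g (c *ᵥ v)
    span-*ᵥ (+ n) s = span-+*ᵥ n s
    span-*ᵥ -[1+ n ] {v} s = ext (λ j → ℤP.neg-distribˡ-* (+ suc n) (v j)) (neg (span-+*ᵥ (suc n) s))

    span-sub : ∀ {v w} → Span g v → Span g w → Span g (v -ᵥ w)
    span-sub s t = add s (neg t)

    span-∑ : ∀ {M} (E : Fin M → V) → (∀ i → Span g (E i)) → Span g (λ j → ∑[ i < M ] E i j)
    span-∑ {zero} E E∈ = zer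
    span-∑ {suc M} E E∈ = add (E∈ zero) (span-∑ (E ∘ suc) (E∈ ∘ suc))

    span-lincomb : ∀ {M} c (E : Fin M → V) → (∀ i → Span g (E i)) → Span g (lincomb c E)
    span-lincomb c E E∈ = span-∑ (λ i → c i *ᵥ E i) (λ i → span-*ᵥ (c i) (E∈ i))

  record IsLinear (φ : V → ℤ) : Set where
    field
      φ-+ : ∀ v w → φ (v +ᵥ w) ≡ φ v + φ w
      φ-cong : ∀ {v w} → (∀ j → v j ≡ w j) → φ v ≡ φ w

    φ-0 : φ (λ _ → 0ℤ) ≡ 0ℤ
    φ-0 = begin
      φ0               ≡⟨ x≡[x+y]-y φ0 φ0 ⟩
      (φ0 + φ0) - φ0   ≡⟨ cong (_- φ0) (φ-+ _ _) ⟨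
      φ0 - φ0          ≡⟨ ℤP.+-inverseʳ φ0 ⟩
      0ℤ               ∎
      where
      open ≡-Reasoning
      φ0 = φ (λ _ → 0ℤ)

    φ-neg : ∀ v → φ (λ j → - v j) ≡ - φ v
    φ-neg v = begin
      φ (λ j → - v j)                      ≡⟨ x≡[x+y]-y (φ (λ j → - v j)) (φ v) ⟩
      (φ (λ j → - v j) + φ v) - φ v        ≡⟨ cong (_- φ v) (φ-+ _ v) ⟨
      φ ((λ j → - v j) +ᵥ v) - φ v         ≡⟨ cong (_- φ v) (φ-cong (λ j → ℤP.+-inverseˡ (v j))) ⟩
      φ (λ _ → 0ℤ) - φ v                   ≡⟨ cong (_- φ v) φ-0 ⟩
      0ℤ - φ v                             ≡⟨ ℤP.+-identityˡ (- φ v) ⟩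
      - φ v                                ∎
      where open ≡-Reasoning

    φ-sub : ∀ v w → φ (v -ᵥ w) ≡ φ v - φ w
    φ-sub v w = trans (φ-+ v _) (cong (_+_ (φ v)) (φ-neg w))

    φ-+*ᵥ : ∀ n v → φ (+ n *ᵥ v) ≡ + n * φ v
    φ-+*ᵥ zero v = φ-0
    φ-+*ᵥ (suc n) v = begin
      φ (+ suc n *ᵥ v)          ≡⟨ φ-cong (λ j → +suc* n (v j)) ⟩
      φ (v +ᵥ (+ n *ᵥ v))       ≡⟨ φ-+ v _ ⟩
      φ v + φ (+ n *ᵥ v)        ≡⟨ cong (_+_ (φ v)) (φ-+*ᵥ n v) ⟩
      φ v + + n * φ v           ≡⟨ +suc* n (φ v) ⟨
      + suc n * φ v             ∎
      where open ≡-Reasoning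

    φ-*ᵥ : ∀ c v → φ (c *ᵥ v) ≡ c * φ v
    φ-*ᵥ (+ n) v = φ-+*ᵥ n v
    φ-*ᵥ -[1+ n ] v = begin
      φ (-[1+ n ] *ᵥ v)              ≡⟨ φ-cong (λ j → sym (ℤP.neg-distribˡ-* (+ suc n) (v j))) ⟩
      φ (λ j → - (+ suc n * v j))    ≡⟨ φ-neg _ ⟩
      - φ (+ suc n *ᵥ v)             ≡⟨ cong -_ (φ-+*ᵥ (suc n) v) ⟩
      - (+ suc n * φ v)              ≡⟨ ℤP.neg-distribˡ-* (+ suc n) (φ v) ⟩
      -[1+ n ] * φ v                 ∎
      where open ≡-Reasoning

    φ-lincomb : ∀ {M} c (E : Fin M → V) → φ (lincomb c E) ≡ ∑[ i < M ] (c i * φ (E i))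
    φ-lincomb {zero} c E = φ-0
    φ-lincomb {suc M} c E = trans (φ-+ _ _)
      (cong₂ _+_ (φ-*ᵥ (c zero) (E zero)) (φ-lincomb (c ∘ suc) (E ∘ suc)))

    ∣-span : ∀ {t} {I : Set} {g : I → V} → (∀ x → t ∣ φ (g x)) → ∀ {v} → Span g v → t ∣ φ v
    ∣-span t∣g (gen x) = t∣g x
    ∣-span t∣g zer = subst (_ ∣_) (sym φ-0) (divides 0ℤ refl)
    ∣-span t∣g (add s s′) =
      subst (_ ∣_) (sym (φ-+ _ _)) (∣m∣n⇒∣m+n (∣-span t∣g s) (∣-span t∣g s′))
    ∣-span t∣g (neg s) = subst (_ ∣_) (sym (φ-neg _)) (∣m⇒∣-m (∣-span t∣g s))
    ∣-span t∣g (ext eq s) = subst (_ ∣_) (φ-cong eq) (∣-span t∣g s)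

  isLinear-*-sub : ∀ c {φ ψ} → IsLinear φ → IsLinear ψ → IsLinear (λ w → c * (φ w - ψ w))
  isLinear-*-sub c {φ} {ψ} φ-linear ψ-linear = record
    { φ-+ = λ v w → trans (cong₂ (λ x y → c * (x - y)) (φ.φ-+ v w) (ψ.φ-+ v w))
                          (distrib c (φ v) (φ w) (ψ v) (ψ w))
    ; φ-cong = λ v≗w → cong₂ (λ x y → c * (x - y)) (φ.φ-cong v≗w) (ψ.φ-cong v≗w)
    }
    where
    module φ = IsLinear φ-linear
    module ψ = IsLinear ψ-linear
    distrib : ∀ c a b x y → c * ((a + b) - (x + y)) ≡ c * (a - x) + c * (b - y)
    distrib = solve-∀

  record LincombMod {I : Set} {M} (g : I → V) (E : Fin M → V) (w : V) : Set where
    constructor _mod_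
    field
      coefficients : Fin M → ℤ
      remainder : Span g (w -ᵥ lincomb coefficients E)

  module _ {I : Set} {g : I → V} {M} (E : Fin M → V) where

    span⇒lincombMod : ∀ {w} → Span g w → LincombMod g E w
    span⇒lincombMod {w} s = (λ _ → 0ℤ) mod ext w≡w-0 s
      where
      w≡w-0 : ∀ j → w j ≡ w j - lincomb (λ _ → 0ℤ) E j
      w≡w-0 j = sym (trans (cong (λ x → w j - x) (∑-zero (λ i → 0ℤ * E i j) (λ _ → refl)))
                           (ℤP.+-identityʳ (w j)))

    lincombMod-E : ∀ i → LincombMod g E (E i)
    lincombMod-E i = (λ j → ind (j FinP.≟ i)) mod ext Ei-Ei≡0 zer
      where
      Ei-Ei≡0 : ∀ x → 0ℤ ≡ E i x - lincomb (λ j → ind (j FinP.≟ i)) E x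
      Ei-Ei≡0 x = sym (trans (cong (λ y → E i x - y)
                                   (trans (sum-cong-≗ (λ j → ℤP.*-comm (ind (j FinP.≟ i)) (E j x)))
                                          (∑-select FinP._≟_ (λ j → j) (λ eq → eq) (λ j → E j x) i)))
                             (ℤP.+-inverseʳ (E i x)))

    lincombMod-cong : ∀ {v w} → (∀ j → v j ≡ w j) → LincombMod g E v → LincombMod g E w
    lincombMod-cong eq (c mod s) = c mod ext (λ j → cong (_- lincomb c E j) (eq j)) s

    lincombMod-+ : ∀ {v w} → LincombMod g E v → LincombMod g E w → LincombMod g E (v +ᵥ w)
    lincombMod-+ {v} {w} (c mod s) (c′ mod t) = (λ i → c i + c′ i) mod ext eq (add s t)
      where
      eq : ∀ j → (v j - lincomb c E j) + (w j - lincomb c′ E j)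
                 ≡ (v j + w j) - lincomb (λ i → c i + c′ i) E j
      eq j = trans (regroup (v j) (w j) _ _) (cong (λ x → (v j + w j) - x) (sym (lincomb-+ c c′ E j)))
        where
        regroup : ∀ a b x y → (a - x) + (b - y) ≡ (a + b) - (x + y)
        regroup = solve-∀

    lincombMod-neg : ∀ {v} → LincombMod g E v → LincombMod g E (λ j → - v j)
    lincombMod-neg {v} (c mod s) = (λ i → - c i) mod ext eq (neg s)
      where
      eq : ∀ j → - (v j - lincomb c E j) ≡ - v j - lincomb (λ i → - c i) E j
      eq j = trans (negate (v j) _) (cong (λ x → - v j - x) (sym (lincomb-neg c E j)))
        where
        negate : ∀ a x → - (a - x) ≡ - a - - x
        negate = solve-∀

    lincombMod-∑ : ∀ {n} (f : Fin n → V) → (∀ a → LincombMod g E (f a)) →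
                   LincombMod g E (λ j → ∑[ a < n ] f a j)
    lincombMod-∑ {zero} f f≡ = span⇒lincombMod zer
    lincombMod-∑ {suc n} f f≡ = lincombMod-+ (f≡ zero) (lincombMod-∑ (f ∘ suc) (f≡ ∘ suc))

    lincombMod-span : ∀ {J : Set} {g′ : J → V} → (∀ y → LincombMod g E (g′ y)) →
                      ∀ {w} → Span g′ w → LincombMod g E w
    lincombMod-span g′≡ (gen y) = g′≡ y
    lincombMod-span g′≡ zer = span⇒lincombMod zer
    lincombMod-span g′≡ (add s t) = lincombMod-+ (lincombMod-span g′≡ s) (lincombMod-span g′≡ t)
    lincombMod-span g′≡ (neg s) = lincombMod-neg (lincombMod-span g′≡ s)
    lincombMod-span g′≡ (ext eq s) = lincombMod-cong eq (lincombMod-span g′≡ s)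

module DualBasis (d h n : ℕ) {M T : ℕ} .{{_ : NonZero T}}
  (E : Fin M → ZVec d h) (φ : Fin M → ZVec d h → ℤ)
  (φ-linear : ∀ i → Vectors.IsLinear d h (φ i))
  (E∈G[n+1] : ∀ i → InG d h (suc n) (E i))
  (TE∈G[n] : ∀ i → InG d h n (Vectors._*ᵥ_ d h (+ T) (E i)))
  (G[n+1]⊆E+G[n] : ∀ y → Vectors.LincombMod d h (gensG d h n) E (gensG d h (suc n) y))
  (φ-G[n] : ∀ i y → + T ∣ φ i (gensG d h n y))
  (φ-E : ∀ i j → + T ∣ Int._-_ (φ i (E j)) (ind (j FinP.≟ i)))
  where

  open Int using (_+_; _*_; _-_; -_)
  open Integers
  open Vectors d h

  φ-lincomb≡ : ∀ i c → + T ∣ φ i (lincomb c E) - c i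
  φ-lincomb≡ i c = subst (+ T ∣_) (sym eq) (∣-∑ _ (λ j → ∣n⇒∣m*n (c j) (φ-E i j)))
    where
    open ≡-Reasoning
    eq : φ i (lincomb c E) - c i ≡ ∑[ j < M ] (c j * (φ i (E j) - ind (j FinP.≟ i)))
    eq = begin
      φ i (lincomb c E) - c i
        ≡⟨ cong₂ _-_ (IsLinear.φ-lincomb (φ-linear i) c E)
                     (sym (∑-select FinP._≟_ (λ j → j) (λ eq → eq) c i)) ⟩
      ∑[ j < M ] (c j * φ i (E j)) - ∑[ j < M ] (c j * ind (j FinP.≟ i))
        ≡⟨ cong (_+_ (∑[ j < M ] (c j * φ i (E j)))) (∑-neg (λ j → c j * ind (j FinP.≟ i))) ⟨
      ∑[ j < M ] (c j * φ i (E j)) + ∑[ j < M ] (- (c j * ind (j FinP.≟ i)))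
        ≡⟨ ∑-distrib-+ (λ j → c j * φ i (E j)) (λ j → - (c j * ind (j FinP.≟ i))) ⟨
      ∑[ j < M ] (c j * φ i (E j) + - (c j * ind (j FinP.≟ i)))
        ≡⟨ sum-cong-≗ (λ j → distrib (c j) (φ i (E j)) (ind (j FinP.≟ i))) ⟩
      ∑[ j < M ] (c j * (φ i (E j) - ind (j FinP.≟ i))) ∎
      where
      distrib : ∀ a x y → a * x + - (a * y) ≡ a * (x - y)
      distrib = solve-∀

  digits : Fin (T ^ M) → Fin M → ℤ
  digits k i = + toℕ (finToFun k i)

  R : Fin (T ^ M) → ZVec d h
  R k = lincomb (digits k) E

  R∈G[n+1] : ∀ k → InG d h (suc n) (R k)
  R∈G[n+1] k = span-lincomb (digits k) E E∈G[n+1]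

  R-injective : ∀ k l → InG d h n (R k -ᵥ R l) → k ≡ l
  R-injective k l Rk-Rl∈G[n] = finToFun-injective (λ i → FinP.toℕ-injective
    (congruent-below⇒≡ (FinP.toℕ<n _) (FinP.toℕ<n _) (digit-congruence i)))
    where
    digit-congruence : ∀ i → + T ∣ digits k i - digits l i
    digit-congruence i = subst (+ T ∣_) (rearrange (φ i (R k)) (φ i (R l)) _ _)
      (∣m∣n⇒∣m+n (∣m∣n⇒∣m-n (subst (+ T ∣_) (IsLinear.φ-sub (φ-linear i) (R k) (R l))
                                     (IsLinear.∣-span (φ-linear i) (φ-G[n] i) Rk-Rl∈G[n]))
                            (φ-lincomb≡ i (digits k)))
                 (φ-lincomb≡ i (digits l)))
      where
      rearrange : ∀ x y a b → ((x - y) - (x - a)) + (y - b) ≡ a - b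
      rearrange = solve-∀

  R-surjective : ∀ w → InG d h (suc n) w → ∃ λ k → InG d h n (w -ᵥ R k)
  R-surjective w w∈G[n+1] with lincombMod-span E G[n+1]⊆E+G[n] w∈G[n+1]
  ... | c mod w-Ec∈G[n] = funToFin residue , ext eq (add w-Ec∈G[n] (span-lincomb quotient _ TE∈G[n]))
    where
    residue : Fin M → Fin T
    residue i = fromℕ< (n%ℕd<d (c i) T)
    quotient : Fin M → ℤ
    quotient i = c i /ℕ T
    digits≡ : ∀ i → digits (funToFin residue) i ≡ + (c i %ℕ T)
    digits≡ i = cong +_ (trans (cong toℕ (FinP.finToFun-funToFin residue i)) (FinP.toℕ-fromℕ< _))
    open ≡-Reasoning
    eq : ∀ j → (w j - lincomb c E j) + lincomb quotient (λ i → + T *ᵥ E i) j ≡ w j - R (funToFin residue) j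
    eq j = begin
      (w j - lincomb c E j) + lincomb quotient (λ i → + T *ᵥ E i) j
        ≡⟨ cong (_+_ (w j - lincomb c E j)) (sum-cong-≗ λ i →
             quotient-term (c i) (+ (c i %ℕ T)) (quotient i) (+ T) (E i j) (a≡a%ℕn+[a/ℕn]*n (c i) T)) ⟩
      (w j - lincomb c E j) + lincomb (λ i → c i + - + (c i %ℕ T)) E j
        ≡⟨ cong (_+_ (w j - lincomb c E j))
             (trans (lincomb-+ c _ E j) (cong (_+_ (lincomb c E j)) (lincomb-neg (λ i → + (c i %ℕ T)) E j))) ⟩
      (w j - lincomb c E j) + (lincomb c E j - lincomb (λ i → + (c i %ℕ T)) E j)
        ≡⟨ telescope (w j) _ _ ⟩
      w j - lincomb (λ i → + (c i %ℕ T)) E j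
        ≡⟨ cong (λ x → w j - x) (sum-cong-≗ (λ i → cong (_* E i j) (sym (digits≡ i)))) ⟩
      w j - R (funToFin residue) j ∎
      where
      quotient-term : ∀ c r q t x → c ≡ r + q * t → q * (t * x) ≡ (c + - r) * x
      quotient-term c r q t x refl = distrib r q t x
        where
        distrib : ∀ r q t x → q * (t * x) ≡ ((r + q * t) + - r) * x
        distrib = solve-∀
      telescope : ∀ a b c → (a - b) + (b - c) ≡ a - c
      telescope = solve-∀

  quotientOrder : QuotientOrder d h n (T ^ M)
  quotientOrder = R , R∈G[n+1] , R-injective , R-surjective

module Paths where

  open Int using (_*_)
  open Integers

  length-∷ʳ : ∀ (p : List ℕ) a → length (p ∷ʳ a) ≡ suc (length p)
  length-∷ʳ p a = trans (ListP.length-++ p) (ℕP.+-comm (length p) 1)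

  parent-∷ʳ : ∀ (p : List ℕ) a → parent (p ∷ʳ a) ≡ just p
  parent-∷ʳ [] a = refl
  parent-∷ʳ (x ∷ []) a = refl
  parent-∷ʳ (x ∷ y ∷ p) a = cong (map (x ∷_)) (parent-∷ʳ (y ∷ p) a)

  parent≡just⇒∷ʳ : ∀ q p → parent q ≡ just p → ∃ λ b → q ≡ p ∷ʳ b
  parent≡just⇒∷ʳ (x ∷ []) p refl = x , refl
  parent≡just⇒∷ʳ (x ∷ y ∷ q) p eq with parent (y ∷ q) in eq′
  parent≡just⇒∷ʳ (x ∷ y ∷ q) .(x ∷ p′) refl | just p′ with parent≡just⇒∷ʳ (y ∷ q) p′ eq′
  ... | b , q≡p′∷ʳb = b , cong (x ∷_) q≡p′∷ʳb

  ∷ʳ-view : ∀ (x : ℕ) q → ∃ λ v → ∃ λ b → x ∷ q ≡ v ∷ʳ b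
  ∷ʳ-view x [] = [] , x , refl
  ∷ʳ-view x (y ∷ q) with ∷ʳ-view y q
  ... | v , b , eq = x ∷ v , b , cong (x ∷_) eq

  ∑-children : ∀ n v q → (∀ b → q ≡ v ∷ʳ b → b < n) →
               ∑[ a < n ] ind ((v ∷ʳ toℕ a) ≟L q) ≡ ind (parent q ≟M just v)
  ∑-children n v q labels< with parent q ≟M just v
  ... | no q∉children = ∑-zero {n} (λ a → ind ((v ∷ʳ toℕ a) ≟L q)) λ a →
    ind-no _ λ eq → q∉children (trans (cong parent (sym eq)) (parent-∷ʳ v (toℕ a)))
  ... | yes q∈children with parent≡just⇒∷ʳ q v q∈children
  ... | b , refl = trans (sum-cong-≗ as-selection) (∑-select _≟L_ child child-injective (λ _ → 1ℤ) j)
    where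
    j : Fin n
    j = fromℕ< (labels< b refl)
    child : Fin n → List ℕ
    child a = v ∷ʳ toℕ a
    child-injective : ∀ {a a′} → child a ≡ child a′ → a ≡ a′
    child-injective eq = FinP.toℕ-injective (ListP.∷ʳ-injectiveʳ v v eq)
    as-selection : ∀ a → ind (child a ≟L (v ∷ʳ b)) ≡ 1ℤ * ind (child a ≟L child j)
    as-selection a = sym (trans (ℤP.*-identityˡ _)
      (cong (λ x → ind (child a ≟L (v ∷ʳ x))) (FinP.toℕ-fromℕ< (labels< b refl))))

module Subtree (m : ℕ) where

  open Int using (_+_; _*_; _-_; -_)
  open Integers
  open Paths

  repunit : ℕ → ℕ
  repunit zero = 0
  repunit (suc r) = suc (repunit r Nat.* m)

  +repunit-suc : ∀ r → + repunit (suc r) ≡ 1ℤ + + repunit r * + m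
  +repunit-suc r = cong (_+_ 1ℤ) (ℤP.pos-* (repunit r) m)

  -- For d = suc m, Defs.delta J is definitionally δ (proj₁ J) ∘ proj₁.
  δ : List ℕ → List ℕ → ℤ
  δ i q = (+ suc m * ind (q ≟L i) - ind (parent i ≟M just q)) - ind (parent q ≟M just i)

  δ-sym : ∀ i q → δ i q ≡ δ q i
  δ-sym i q = trans (cong (λ x → (+ suc m * x - ind (parent i ≟M just q)) - ind (parent q ≟M just i))
                          (ind-≟L-sym q i))
                    (swap (+ suc m * ind (i ≟L q)) (ind (parent i ≟M just q)) (ind (parent q ≟M just i)))
    where
    swap : ∀ a x y → (a - x) - y ≡ (a - y) - x
    swap = solve-∀

  Descendant : ℕ → List ℕ → List ℕ → Set
  Descendant r p q = ∃ λ s → q ≡ p ++ s × All (_< m) s × length s < r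

  Confined : ℕ → List ℕ → List ℕ → Set
  Confined r p i = ∀ s → i ≡ p ++ s → All (_< m) s × length s < r

  descendant-root : ∀ r p → Descendant (suc r) p p
  descendant-root r p = [] , sym (ListP.++-identityʳ p) , [] , s≤s z≤n

  descendant-child : ∀ {r p q} (a : Fin m) → Descendant r (p ∷ʳ toℕ a) q → Descendant (suc r) p q
  descendant-child {p = p} a (s , refl , all< , len<) =
    toℕ a ∷ s , ListP.∷ʳ-++ p (toℕ a) s , FinP.toℕ<n a ∷ all< , s≤s len<

  descendant-child≢ : ∀ {r p q} a → Descendant r (p ∷ʳ a) q → q ≢ p
  descendant-child≢ {p = p} a (s , refl , _) eq =
    ℕP.m+1+n≢m (length p) (trans (sym (ListP.length-++ p)) (cong length (trans (sym (ListP.∷ʳ-++ p a s)) eq)))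

  descendant-≥ : ∀ {r p q} → Descendant r p q → length p ≤ length q
  descendant-≥ {p = p} (s , refl , _) = ListP.length-++-≤ˡ p

  descendant-≡ : ∀ {r p q} → Descendant r p q → length q ≡ length p → q ≡ p
  descendant-≡ {p = p} ([] , refl , _) _ = ListP.++-identityʳ p
  descendant-≡ {p = p} (b ∷ s , refl , _) eq =
    ⊥-elim (ℕP.m+1+n≢m (length p) (trans (sym (ListP.length-++ p)) eq))

  confined-child : ∀ {r p i} a → Confined (suc r) p i → Confined r (p ∷ʳ a) i
  confined-child {p = p} a confined s refl with confined (a ∷ s) (ListP.∷ʳ-++ p a s)
  ... | _ ∷ all< , s≤s len< = all< , len<

  -- Ψ r p F = Σ repunit (r − dist(p,q)) · F q over the descendants q of p at distance < r.
  Ψ : ℕ → List ℕ → (List ℕ → ℤ) → ℤ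
  Ψ zero p F = 0ℤ
  Ψ (suc r) p F = + repunit (suc r) * F p + ∑[ a < m ] Ψ r (p ∷ʳ toℕ a) F

  Ψ-cong : ∀ r p {F G} → (∀ q → Descendant r p q → F q ≡ G q) → Ψ r p F ≡ Ψ r p G
  Ψ-cong zero p F≗G = refl
  Ψ-cong (suc r) p F≗G = cong₂ (λ x y → + repunit (suc r) * x + y) (F≗G p (descendant-root r p))
    (sum-cong-≗ λ a → Ψ-cong r (p ∷ʳ toℕ a) (λ q → F≗G q ∘ descendant-child a))

  Ψ-+ : ∀ r p F G → Ψ r p (λ q → F q + G q) ≡ Ψ r p F + Ψ r p G
  Ψ-+ zero p F G = refl
  Ψ-+ (suc r) p F G = trans
    (cong₂ _+_ (ℤP.*-distribˡ-+ (+ repunit (suc r)) (F p) (G p))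
               (trans (sum-cong-≗ {m} λ a → Ψ-+ r (p ∷ʳ toℕ a) F G)
                      (∑-distrib-+ {m} (λ a → Ψ r (p ∷ʳ toℕ a) F) (λ a → Ψ r (p ∷ʳ toℕ a) G))))
    (interchange (+ repunit (suc r) * F p) (+ repunit (suc r) * G p) _ _)
    where
    interchange : ∀ a b x y → (a + b) + (x + y) ≡ (a + x) + (b + y)
    interchange = solve-∀

  Ψ-vanish : ∀ r p F → (∀ q → Descendant r p q → F q ≡ 0ℤ) → Ψ r p F ≡ 0ℤ
  Ψ-vanish zero p F F≡0 = refl
  Ψ-vanish (suc r) p F F≡0 =
    cong₂ _+_ (trans (cong (_*_ (+ repunit (suc r))) (F≡0 p (descendant-root r p)))
                     (ℤP.*-zeroʳ (+ repunit (suc r))))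
              (∑-zero {m} _ λ a → Ψ-vanish r (p ∷ʳ toℕ a) F (λ q → F≡0 q ∘ descendant-child a))

  Ψ-root : ∀ r p F → (∀ q → Descendant (suc r) p q → q ≢ p → F q ≡ 0ℤ) →
           Ψ (suc r) p F ≡ + repunit (suc r) * F p
  Ψ-root r p F F≡0 = trans
    (cong (_+_ (+ repunit (suc r) * F p))
          (∑-zero {m} _ λ a → Ψ-vanish r (p ∷ʳ toℕ a) F λ q d →
             F≡0 q (descendant-child a d) (descendant-child≢ (toℕ a) d)))
    (ℤP.+-identityʳ _)

  δ-step : ∀ r X P Q →
    + repunit (suc r) * ((+ suc m * X - P) - Q) + (+ repunit (suc r) * P + + m * - (+ repunit r * X))
      ≡ + repunit (suc (suc r)) * X - + repunit (suc r) * Q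
  δ-step r X P Q = expand (+ m) (+ repunit r) _ _ X P Q (+repunit-suc r) (+repunit-suc (suc r))
    where
    expand : ∀ m t₀ t₁ t₂ X P Q → t₁ ≡ 1ℤ + t₀ * m → t₂ ≡ 1ℤ + t₁ * m →
      t₁ * (((1ℤ + m) * X - P) - Q) + (t₁ * P + m * - (t₀ * X)) ≡ t₂ * X - t₁ * Q
    expand m t₀ _ _ X P Q refl refl = solve m t₀ X P Q
      where
      solve : ∀ m t X P Q →
        (1ℤ + t * m) * (((1ℤ + m) * X - P) - Q) + ((1ℤ + t * m) * P + m * - (t * X))
          ≡ (1ℤ + (1ℤ + t * m) * m) * X - (1ℤ + t * m) * Q
      solve = solve-∀

  -- Inside the subtree the contributions of δ i cancel, by repunit (s+1) = 1 + repunit s · m (δ-step).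
  Ψ-δ : ∀ r p i → Confined r p i →
        Ψ r p (δ i) ≡ + repunit (suc r) * ind (p ≟L i) - + repunit r * ind (parent p ≟M just i)
  Ψ-δ zero p i confined = sym (cong (λ x → + repunit 1 * x - + repunit 0 * ind (parent p ≟M just i))
    (ind-no (p ≟L i) λ { refl → ℕP.n≮0 (proj₂ (confined [] (sym (ListP.++-identityʳ p)))) }))
  Ψ-δ (suc r) p i confined = begin
      t₁ * δ i p + ∑[ a < m ] Ψ r (child a) (δ i)
    ≡⟨ cong (_+_ (t₁ * δ i p)) (sum-cong-≗ λ a → trans (Ψ-δ r (child a) i (confined-child (toℕ a) confined))
         (cong (λ x → t₁ * ind (child a ≟L i) - t₀ * x)
               (trans (cong (λ x → ind (x ≟M just i)) (parent-∷ʳ p (toℕ a))) (ind-just p i)))) ⟩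
      t₁ * δ i p + ∑[ a < m ] (t₁ * ind (child a ≟L i) + - (t₀ * X))
    ≡⟨ cong (_+_ (t₁ * δ i p)) (∑-distrib-+ (λ a → t₁ * ind (child a ≟L i)) (λ _ → - (t₀ * X))) ⟩
      t₁ * δ i p + (∑[ a < m ] (t₁ * ind (child a ≟L i)) + ∑[ a < m ] (- (t₀ * X)))
    ≡⟨ cong (_+_ (t₁ * δ i p)) (cong₂ _+_
         (trans (sym (*-distribˡ-sum t₁ (λ a → ind (child a ≟L i))))
                (cong (_*_ t₁) (∑-children m p i λ b eq → All.head (proj₁ (confined (b ∷ []) eq)))))
         (∑-const m (- (t₀ * X)))) ⟩
      t₁ * ((+ suc m * X - P) - Q) + (t₁ * P + + m * - (t₀ * X))
    ≡⟨ δ-step r X P Q ⟩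
      + repunit (suc (suc r)) * X - t₁ * Q ∎
    where
    open ≡-Reasoning
    child : Fin m → List ℕ
    child a = p ∷ʳ toℕ a
    t₀ = + repunit r
    t₁ = + repunit (suc r)
    X = ind (p ≟L i)
    P = ind (parent i ≟M just p)
    Q = ind (parent p ≟M just i)

module Level (m n k : ℕ) where

  open Int using (_+_; _*_; _-_; -_)
  open Integers
  open Paths
  open Subtree m

  d h : ℕ
  d = suc m
  h = suc (n Nat.+ k)

  open Vectors d h

  Valid : List ℕ → Set
  Valid q = length q ≤ h × Labels d q

  labels? : ∀ q → Dec (Labels d q)
  labels? [] = yes tt
  labels? (c ∷ cs) = (c ℕP.<? d) ×-dec All.all? (ℕP._<? m) cs

  valid? : ∀ q → Dec (Valid q)
  valid? q = (length q ℕP.≤? h) ×-dec labels? q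

  labels-prefix : ∀ p s → Labels d (p ++ s) → Labels d p
  labels-prefix [] s _ = tt
  labels-prefix (y ∷ p) s (y< , all<) = y< , AllP.++⁻ˡ p all<

  OnNextLevel : List ℕ → Set
  OnNextLevel p = length p ≡ suc n × Labels d p

  shallow-valid : ∀ {p} → length p ≤ suc n → Labels d p → Valid p
  shallow-valid p≤n+1 p-labels = ℕP.≤-trans p≤n+1 (s≤s (ℕP.m≤m+n n k)) , p-labels

  descendant-valid : ∀ {p q} → OnNextLevel p → Descendant (suc k) p q → Valid q
  descendant-valid {y ∷ p} (refl , y< , all<) (s , refl , s< , s≤k) =
    s≤s (ℕP.≤-trans (ℕP.≤-reflexive (ListP.length-++ p)) (ℕP.+-monoʳ-≤ (length p) (ℕP.≤-pred s≤k))) ,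
    y< , AllP.++⁺ all< s<

  valid-confined : ∀ {p J} → OnNextLevel p → Valid J → Confined (suc k) p J
  valid-confined {y ∷ p} (refl , _) (J≤h , _ , all<) s refl =
    AllP.++⁻ʳ p all< ,
    s≤s (ℕP.+-cancelˡ-≤ (length p) _ _
          (ℕP.≤-trans (ℕP.≤-reflexive (sym (ListP.length-++ p))) (ℕP.≤-pred J≤h)))

  lift : V → List ℕ → ℤ
  lift w q with valid? q
  ... | yes q-valid = w (q , q-valid)
  ... | no _ = 0ℤ

  lift-+ : ∀ v w q → lift (v +ᵥ w) q ≡ lift v q + lift w q
  lift-+ v w q with valid? q
  ... | yes _ = refl
  ... | no _ = refl

  lift-cong : ∀ {v w} → (∀ j → v j ≡ w j) → ∀ q → lift v q ≡ lift w q
  lift-cong v≗w q with valid? q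
  ... | yes q-valid = v≗w (q , q-valid)
  ... | no _ = refl

  lift-proj₁ : ∀ (f : List ℕ → ℤ) q → Valid q → lift (f ∘ proj₁) q ≡ f q
  lift-proj₁ f q q-valid with valid? q
  ... | yes _ = refl
  ... | no invalid = ⊥-elim (invalid q-valid)

  ψ : List ℕ → V → ℤ
  ψ p w = Ψ (suc k) p (lift w)

  ψ-linear : ∀ p → IsLinear (ψ p)
  ψ-linear p = record
    { φ-+ = λ v w → trans (Ψ-cong (suc k) p (λ q _ → lift-+ v w q)) (Ψ-+ (suc k) p (lift v) (lift w))
    ; φ-cong = λ v≗w → Ψ-cong (suc k) p (λ q _ → lift-cong v≗w q)
    }

  ψ-delta : ∀ {v b} → OnNextLevel (v ∷ʳ b) → ∀ J →
            ψ (v ∷ʳ b) (delta J) ≡ + repunit (suc (suc k)) * ind ((v ∷ʳ b) ≟L proj₁ J)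
                                   - + repunit (suc k) * ind (v ≟L proj₁ J)
  ψ-delta {v} {b} next J = begin
    Ψ (suc k) (v ∷ʳ b) (lift (delta J))
      ≡⟨ Ψ-cong (suc k) (v ∷ʳ b) (λ q desc → lift-proj₁ (δ (proj₁ J)) q (descendant-valid next desc)) ⟩
    Ψ (suc k) (v ∷ʳ b) (δ (proj₁ J))
      ≡⟨ Ψ-δ (suc k) (v ∷ʳ b) (proj₁ J) (valid-confined next (proj₂ J)) ⟩
    t₂ * ind ((v ∷ʳ b) ≟L proj₁ J) - t₁ * ind (parent (v ∷ʳ b) ≟M just (proj₁ J))
      ≡⟨ cong (λ x → t₂ * ind ((v ∷ʳ b) ≟L proj₁ J) - t₁ * x)
              (trans (cong (λ z → ind (z ≟M just (proj₁ J))) (parent-∷ʳ v b)) (ind-just v (proj₁ J))) ⟩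
    t₂ * ind ((v ∷ʳ b) ≟L proj₁ J) - t₁ * ind (v ≟L proj₁ J) ∎
    where
    open ≡-Reasoning
    t₁ = + repunit (suc k)
    t₂ = + repunit (suc (suc k))

  ψ-basis-below : ∀ {p} → OnNextLevel p → ∀ J → length (proj₁ J) ≤ n → ψ p (basis J) ≡ 0ℤ
  ψ-basis-below {p} p-next J J≤n = Ψ-vanish (suc k) p _ λ q desc →
    trans (lift-proj₁ (λ q → ind (q ≟L proj₁ J)) q (descendant-valid p-next desc))
          (ind-no _ λ { refl →
            ℕP.<⇒≱ (ℕP.≤-trans (ℕP.≤-reflexive (sym (proj₁ p-next))) (descendant-≥ desc)) J≤n })

  ψ-basis-level : ∀ {p} → OnNextLevel p → ∀ J → length (proj₁ J) ≡ suc n →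
                  ψ p (basis J) ≡ + repunit (suc k) * ind (p ≟L proj₁ J)
  ψ-basis-level {p} p-next J J-next = trans
    (Ψ-root k p _ λ q desc q≢p →
      trans (lift-proj₁ (λ q → ind (q ≟L proj₁ J)) q (descendant-valid p-next desc))
            (ind-no _ λ { refl → q≢p (descendant-≡ desc (trans J-next (sym (proj₁ p-next)))) }))
    (cong (_*_ (+ repunit (suc k)))
          (lift-proj₁ (λ q → ind (q ≟L proj₁ J)) p (descendant-valid p-next (descendant-root k p))))

  Gₙ : V → Set
  Gₙ = InG d h n

  Ψ-δ∈Gₙ : ∀ r p → (∀ q → Descendant r p q → Valid q) → Gₙ (λ J → Ψ r p (λ q → δ q (proj₁ J)))
  Ψ-δ∈Gₙ zero p _ = zer
  Ψ-δ∈Gₙ (suc r) p valid =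
    add (span-*ᵥ (+ repunit (suc r)) (gen (inj₂ (p , valid p (descendant-root r p)))))
        (span-∑ _ λ a → Ψ-δ∈Gₙ r (p ∷ʳ toℕ a) (λ q → valid q ∘ descendant-child a))

  -- θ(k+2)·x_p = θ(k+1)·x_{p(p)} + Σ_q θ(k+1−dist(p,q))·δ_q over the subtree below p.
  repunit*basis∈Gₙ : ∀ (P U : Vertex d h) → OnNextLevel (proj₁ P) → parent (proj₁ P) ≡ just (proj₁ U) →
                     length (proj₁ U) ≤ n → Gₙ (+ repunit (suc (suc k)) *ᵥ basis P)
  repunit*basis∈Gₙ (p , _) (u , u-valid) p-next p↑u u≤n =
    ext pointwise (add (Ψ-δ∈Gₙ (suc k) p (λ q → descendant-valid p-next))
                       (span-*ᵥ (+ repunit (suc k)) (gen (inj₁ ((u , u-valid) , u≤n)))))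
    where
    pointwise : ∀ J → Ψ (suc k) p (λ q → δ q (proj₁ J)) + + repunit (suc k) * ind (proj₁ J ≟L u)
                      ≡ + repunit (suc (suc k)) * ind (proj₁ J ≟L p)
    pointwise J = begin
      Ψ (suc k) p (λ q → δ q (proj₁ J)) + t₁ * ind (proj₁ J ≟L u)
        ≡⟨ cong (_+ t₁ * ind (proj₁ J ≟L u)) (trans (Ψ-cong (suc k) p (λ q _ → δ-sym q (proj₁ J)))
                                                    (Ψ-δ (suc k) p (proj₁ J) (valid-confined p-next (proj₂ J)))) ⟩
      (t₂ * ind (p ≟L proj₁ J) - t₁ * ind (parent p ≟M just (proj₁ J))) + t₁ * ind (proj₁ J ≟L u)
        ≡⟨ cong₂ (λ x y → (t₂ * x - t₁ * y) + t₁ * ind (proj₁ J ≟L u)) (ind-≟L-sym p (proj₁ J))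
             (trans (cong (λ x → ind (x ≟M just (proj₁ J))) p↑u)
                    (trans (ind-just u (proj₁ J)) (ind-≟L-sym u (proj₁ J)))) ⟩
      (t₂ * ind (proj₁ J ≟L p) - t₁ * ind (proj₁ J ≟L u)) + t₁ * ind (proj₁ J ≟L u)
        ≡⟨ cancel (t₂ * ind (proj₁ J ≟L p)) (t₁ * ind (proj₁ J ≟L u)) ⟩
      t₂ * ind (proj₁ J ≟L p) ∎
      where
      open ≡-Reasoning
      t₁ = + repunit (suc k)
      t₂ = + repunit (suc (suc k))
      cancel : ∀ a b → (a - b) + b ≡ a
      cancel = solve-∀

  parent-basis∈Gₙ : ∀ v → Valid v → length v ≤ n → Gₙ (λ J → ind (parent v ≟M just (proj₁ J)))
  parent-basis∈Gₙ v v-valid v≤n with parent v in v↑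
  ... | nothing = ext (λ J → sym (ind-no (nothing ≟M just (proj₁ J)) λ ())) zer
  ... | just u with parent≡just⇒∷ʳ v u v↑
  ... | b , refl = ext (λ J → trans (ind-≟L-sym (proj₁ J) u) (sym (ind-just u (proj₁ J))))
                       (gen (inj₁ ((u , u≤h , labels-prefix u (b ∷ []) (proj₂ v-valid)) , u≤n)))
    where
    u<v : length u < length (u ∷ʳ b)
    u<v = ℕP.≤-reflexive (sym (length-∷ʳ u b))
    u≤n = ℕP.<⇒≤ (ℕP.<-≤-trans u<v v≤n)
    u≤h = ℕP.<⇒≤ (ℕP.<-≤-trans u<v (proj₁ v-valid))

  -- Σ_{children c of v} x_c = d·x_v − x_{p(v)} − δ_v.
  children∈Gₙ : ∀ (V : Vertex d h) → length (proj₁ V) ≡ n →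
                ∀ c → (∀ b → Labels d (proj₁ V ∷ʳ b) → b < c) →
                Gₙ (λ J → ∑[ a < c ] ind (proj₁ J ≟L (proj₁ V ∷ʳ toℕ a)))
  children∈Gₙ (v , v-valid) v≡n c labels< =
    ext pointwise (span-sub (span-sub (span-*ᵥ (+ d) (gen (inj₁ ((v , v-valid) , ℕP.≤-reflexive v≡n))))
                                      (parent-basis∈Gₙ v v-valid (ℕP.≤-reflexive v≡n)))
                            (gen (inj₂ (v , v-valid))))
    where
    pointwise : ∀ J → (+ d * ind (proj₁ J ≟L v) - ind (parent v ≟M just (proj₁ J))) - δ v (proj₁ J)
                      ≡ ∑[ a < c ] ind (proj₁ J ≟L (v ∷ʳ toℕ a))
    pointwise J = begin
      (x - ind (parent v ≟M just (proj₁ J))) - δ v (proj₁ J)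
        ≡⟨ cancel (x - ind (parent v ≟M just (proj₁ J))) (ind (parent (proj₁ J) ≟M just v)) ⟩
      ind (parent (proj₁ J) ≟M just v)
        ≡⟨ ∑-children c v (proj₁ J) (λ b J≡v∷b → labels< b (subst (Labels d) J≡v∷b (proj₂ (proj₂ J))))
         ⟨
      ∑[ a < c ] ind ((v ∷ʳ toℕ a) ≟L proj₁ J)
        ≡⟨ sum-cong-≗ {c} (λ a → ind-≟L-sym (v ∷ʳ toℕ a) (proj₁ J)) ⟩
      ∑[ a < c ] ind (proj₁ J ≟L (v ∷ʳ toℕ a)) ∎
      where
      open ≡-Reasoning
      x = + d * ind (proj₁ J ≟L v)
      cancel : ∀ a b → a - (a - b) ≡ b
      cancel = solve-∀

  -- Every depth-n vertex v has children labelled 0, …, last; Fin M enumerates, via pos and lab,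
  -- the pairs (v, b) with b < last, i.e. all depth-(n+1) vertices except the last child of each v.
  module Coordinates (last : ℕ)
    (child-label< : ∀ v b → length v ≡ n → Labels d (v ∷ʳ b) → b < suc last)
    (child-labels : ∀ v b → length v ≡ n → Labels d v → b < suc last → Labels d (v ∷ʳ b))
    {M : ℕ} (pos : Fin M → List ℕ) (lab : Fin M → ℕ)
    (pos-level : ∀ i → length (pos i) ≡ n) (pos-labels : ∀ i → Labels d (pos i)) (lab< : ∀ i → lab i < last)
    (enum-injective : ∀ {i j} → pos i ≡ pos j → lab i ≡ lab j → i ≡ j)
    (enum-surjective : ∀ v b → length v ≡ n → Labels d v → b < last → ∃ λ i → pos i ≡ v × lab i ≡ b)
    where

    T : ℕ
    T = repunit (suc (suc k))

    child-next : ∀ v b → length v ≡ n → Labels d v → b < suc last → OnNextLevel (v ∷ʳ b)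
    child-next v b v≡n v-labels b≤last =
      trans (length-∷ʳ v b) (cong suc v≡n) , child-labels v b v≡n v-labels b≤last

    pos-valid : ∀ i → Valid (pos i)
    pos-valid i = shallow-valid (ℕP.≤-trans (ℕP.≤-reflexive (pos-level i)) (ℕP.n≤1+n n)) (pos-labels i)

    chosen omitted : Fin M → List ℕ
    chosen i = pos i ∷ʳ lab i
    omitted i = pos i ∷ʳ last

    chosen-next : ∀ i → OnNextLevel (chosen i)
    chosen-next i = child-next (pos i) (lab i) (pos-level i) (pos-labels i) (ℕP.m<n⇒m<1+n (lab< i))

    omitted-next : ∀ i → OnNextLevel (omitted i)
    omitted-next i = child-next (pos i) last (pos-level i) (pos-labels i) ℕP.≤-refl

    chosen-vertex : Fin M → Vertex d h
    chosen-vertex i = chosen i , shallow-valid (ℕP.≤-reflexive (proj₁ (chosen-next i))) (proj₂ (chosen-next i))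

    E : Fin M → V
    E i = basis (chosen-vertex i)

    φ : Fin M → V → ℤ
    φ i w = - + m * (ψ (chosen i) w - ψ (omitted i) w)

    E≡child : ∀ {i v b} → pos i ≡ v → lab i ≡ b → ∀ J → E i J ≡ ind (proj₁ J ≟L (v ∷ʳ b))
    E≡child pos≡ lab≡ J = cong₂ (λ x y → ind (proj₁ J ≟L (x ∷ʳ y))) pos≡ lab≡

    non-last-child≡E : ∀ v a → length v ≡ n → Labels d v → a < last →
                       LincombMod (gensG d h n) E (λ J → ind (proj₁ J ≟L (v ∷ʳ a)))
    non-last-child≡E v a v≡n v-labels a<last with enum-surjective v a v≡n v-labels a<last
    ... | i , pos≡ , lab≡ = lincombMod-cong E (E≡child pos≡ lab≡) (lincombMod-E E i)

    -- x at the last child of v is Σ_{children c} x_c minus the E's of the other children.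
    last-child≡E+Gₙ : ∀ v → Valid v → length v ≡ n →
                      LincombMod (gensG d h n) E (λ J → ind (proj₁ J ≟L (v ∷ʳ last)))
    last-child≡E+Gₙ v v-valid v≡n =
      lincombMod-cong E pointwise
        (lincombMod-+ E (span⇒lincombMod E (children∈Gₙ (v , v-valid) v≡n (suc last)
                                                         (λ b → child-label< v b v≡n)))
                        (lincombMod-neg E (lincombMod-∑ E _ λ a →
                           non-last-child≡E v (toℕ a) v≡n (proj₂ v-valid) (FinP.toℕ<n a))))
      where
      pointwise : ∀ J → ∑[ a < suc last ] ind (proj₁ J ≟L (v ∷ʳ toℕ a))
                          + - ∑[ a < last ] ind (proj₁ J ≟L (v ∷ʳ toℕ a))
                        ≡ ind (proj₁ J ≟L (v ∷ʳ last))
      pointwise J = begin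
        ∑[ a < suc last ] x (toℕ a) + - ∑[ a < last ] x (toℕ a)
          ≡⟨ cong (_+ - ∑[ a < last ] x (toℕ a)) (sum-init-last {last} (x ∘ toℕ)) ⟩
        (∑[ a < last ] x (toℕ (Fin.inject₁ a)) + x (toℕ (Fin.fromℕ last))) + - ∑[ a < last ] x (toℕ a)
          ≡⟨ cong₂ (λ s y → (s + y) + - ∑[ a < last ] x (toℕ a))
                   (sum-cong-≗ {last} (cong x ∘ FinP.toℕ-inject₁)) (cong x (FinP.toℕ-fromℕ last)) ⟩
        (∑[ a < last ] x (toℕ a) + x last) + - ∑[ a < last ] x (toℕ a)
          ≡⟨ cancel (∑[ a < last ] x (toℕ a)) (x last) ⟩
        x last ∎
        where
        open ≡-Reasoning
        x : ℕ → ℤ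
        x a = ind (proj₁ J ≟L (v ∷ʳ a))
        cancel : ∀ s y → (s + y) + - s ≡ y
        cancel = solve-∀

    child≡E+Gₙ : ∀ v b → length v ≡ n → Labels d (v ∷ʳ b) →
                 LincombMod (gensG d h n) E (λ J → ind (proj₁ J ≟L (v ∷ʳ b)))
    child≡E+Gₙ v b v≡n child-labels with b ℕP.<? last
    ... | yes b<last = non-last-child≡E v b v≡n (labels-prefix v (b ∷ []) child-labels) b<last
    ... | no b≮last = subst (λ b → LincombMod (gensG d h n) E (λ J → ind (proj₁ J ≟L (v ∷ʳ b))))
                            (sym b≡last) (last-child≡E+Gₙ v v-valid v≡n)
      where
      v-valid : Valid v
      v-valid = shallow-valid (ℕP.≤-trans (ℕP.≤-reflexive v≡n) (ℕP.n≤1+n n))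
                              (labels-prefix v (b ∷ []) child-labels)
      b≡last : b ≡ last
      b≡last = ℕP.≤-antisym (ℕP.≤-pred (child-label< v b v≡n child-labels)) (ℕP.≮⇒≥ b≮last)

    level-basis≡E+Gₙ : ∀ (J : Vertex d h) → length (proj₁ J) ≡ suc n →
                       LincombMod (gensG d h n) E (basis J)
    level-basis≡E+Gₙ ([] , _) ()
    level-basis≡E+Gₙ (x ∷ q , _ , q-labels) q≡n+1 with ∷ʳ-view x q
    ... | v , b , q≡v∷b = lincombMod-cong E (λ J → cong (λ y → ind (proj₁ J ≟L y)) (sym q≡v∷b))
      (child≡E+Gₙ v b v≡n (subst (Labels d) q≡v∷b q-labels))
      where
      v≡n = ℕP.suc-injective (trans (sym (length-∷ʳ v b)) (trans (cong length (sym q≡v∷b)) q≡n+1))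

    G[n+1]⊆E+Gₙ : ∀ y → LincombMod (gensG d h n) E (gensG d h (suc n) y)
    G[n+1]⊆E+Gₙ (inj₁ (J , J≤n+1)) with length (proj₁ J) ℕP.≤? n
    ... | yes J≤n = span⇒lincombMod E (gen (inj₁ (J , J≤n)))
    ... | no J≰n = level-basis≡E+Gₙ J (ℕP.≤-antisym J≤n+1 (ℕP.≰⇒> J≰n))
    G[n+1]⊆E+Gₙ (inj₂ J) = span⇒lincombMod E (gen (inj₂ J))

    T*E∈Gₙ : ∀ i → Gₙ (+ T *ᵥ E i)
    T*E∈Gₙ i = repunit*basis∈Gₙ (chosen-vertex i) (pos i , pos-valid i) (chosen-next i)
                                (parent-∷ʳ (pos i) (lab i)) (ℕP.≤-reflexive (pos-level i))

    φ-linear : ∀ i → IsLinear (φ i)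
    φ-linear i = isLinear-*-sub (- + m) (ψ-linear (chosen i)) (ψ-linear (omitted i))

    φ-Gₙ : ∀ i y → + T ∣ φ i (gensG d h n y)
    φ-Gₙ i (inj₁ (J , J≤n)) = divides 0ℤ (trans
      (cong₂ (λ x y → - + m * (x - y)) (ψ-basis-below (chosen-next i) J J≤n)
                                       (ψ-basis-below (omitted-next i) J J≤n))
      (ℤP.*-zeroʳ (- + m)))
    φ-Gₙ i (inj₂ J) = divides (- + m * (X - Y)) (trans
      (cong₂ (λ x y → - + m * (x - y)) (ψ-delta (chosen-next i) J) (ψ-delta (omitted-next i) J))
      (factor (- + m) t₂ t₁ X Y (ind (pos i ≟L proj₁ J))))
      where
      t₁ = + repunit (suc k)
      t₂ = + repunit (suc (suc k))
      X = ind (chosen i ≟L proj₁ J)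
      Y = ind (omitted i ≟L proj₁ J)
      factor : ∀ c t s X Y P → c * ((t * X - s * P) - (t * Y - s * P)) ≡ (c * (X - Y)) * t
      factor = solve-∀

    φ-E : ∀ i j → + T ∣ φ i (E j) - ind (j FinP.≟ i)
    φ-E i j = divides (- K) (begin
      φ i (E j) - K
        ≡⟨ cong (_- K) (cong₂ (λ x y → - + m * (x - y)) (ψ-basis-level (chosen-next i) Eⱼ (proj₁ (chosen-next j)))
                                                       (ψ-basis-level (omitted-next i) Eⱼ (proj₁ (chosen-next j)))) ⟩
      - + m * (t₁ * ind (chosen i ≟L chosen j) - t₁ * ind (omitted i ≟L chosen j)) - K
        ≡⟨ cong₂ (λ x y → - + m * (t₁ * x - t₁ * y) - K) chosen≡ omitted≢ ⟩
      - + m * (t₁ * K - t₁ * 0ℤ) - K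
        ≡⟨ expand (+ m) t₁ K ⟩
      - K * (1ℤ + t₁ * + m)
        ≡⟨ cong (_*_ (- K)) (+repunit-suc (suc k)) ⟨
      - K * + T ∎)
      where
      open ≡-Reasoning
      t₁ = + repunit (suc k)
      Eⱼ = chosen-vertex j
      K = ind (j FinP.≟ i)
      chosen≡ : ind (chosen i ≟L chosen j) ≡ K
      chosen≡ = ind-cong _ _ (λ eq → sym (enum-injective (ListP.∷ʳ-injectiveˡ (pos i) (pos j) eq)
                                                         (ListP.∷ʳ-injectiveʳ (pos i) (pos j) eq)))
                             (λ { refl → refl })
      omitted≢ : ind (omitted i ≟L chosen j) ≡ 0ℤ
      omitted≢ = ind-no _ λ eq → ℕP.<-irrefl (sym (ListP.∷ʳ-injectiveʳ (pos i) (pos j) eq)) (lab< j)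
      expand : ∀ m t K → - m * (t * K - t * 0ℤ) - K ≡ - K * (1ℤ + t * m)
      expand = solve-∀

    quotientOrder : QuotientOrder d h n (T ^ M)
    quotientOrder = DualBasis.quotientOrder d h n E φ φ-linear
      (λ i → gen (inj₁ (chosen-vertex i , ℕP.≤-reflexive (proj₁ (chosen-next i)))))
      T*E∈Gₙ G[n+1]⊆E+Gₙ φ-Gₙ φ-E

module Words (m : ℕ) where

  word : ∀ n → Fin (m ^ n) → List ℕ
  word zero _ = []
  word (suc n) w = toℕ (Fin.quotient {m} (m ^ n) w) ∷ word n (Fin.remainder {m} (m ^ n) w)

  word-length : ∀ n w → length (word n w) ≡ n
  word-length zero w = refl
  word-length (suc n) w = cong suc (word-length n _)

  word-labels : ∀ n w → All (_< m) (word n w)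
  word-labels zero w = []
  word-labels (suc n) w = FinP.toℕ<n _ ∷ word-labels n _

  word-injective : ∀ n {w w′} → word n w ≡ word n w′ → w ≡ w′
  word-injective zero {zero} {zero} _ = refl
  word-injective (suc n) eq = remQuot-injective {m} (m ^ n)
    (FinP.toℕ-injective (ListP.∷-injectiveˡ eq)) (word-injective n (ListP.∷-injectiveʳ eq))

  word-surjective : ∀ n xs → length xs ≡ n → All (_< m) xs → ∃ λ w → word n w ≡ xs
  word-surjective zero [] refl [] = zero , refl
  word-surjective (suc n) (x ∷ xs) refl (x<m ∷ xs<m) with word-surjective n xs refl xs<m
  ... | w , word≡xs = combine (fromℕ< x<m) w ,
    cong₂ _∷_ (trans (cong (toℕ ∘ proj₁) split) (FinP.toℕ-fromℕ< x<m))
              (trans (cong (word n ∘ proj₂) split) word≡xs)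
    where split = FinP.remQuot-combine {m} {m ^ n} (fromℕ< x<m) w

quotientOrder-root : ∀ m k → QuotientOrder (suc m) (suc k) 0 (Subtree.repunit m (suc (suc k)) ^ m)
quotientOrder-root m k =
  Coordinates.quotientOrder m child-label< child-labels (λ _ → []) toℕ (λ _ → refl) (λ _ → tt) FinP.toℕ<n
    (λ _ → FinP.toℕ-injective) enum-surjective
  where
  open Level m 0 k
  child-label< : ∀ v b → length v ≡ 0 → Labels d (v ∷ʳ b) → b < suc m
  child-label< [] b _ (b<d , _) = b<d
  child-labels : ∀ v b → length v ≡ 0 → Labels d v → b < suc m → Labels d (v ∷ʳ b)
  child-labels [] b _ _ b<d = b<d , []
  enum-surjective : ∀ v b → length v ≡ 0 → Labels d v → b < m → ∃ λ i → [] ≡ v × toℕ i ≡ b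
  enum-surjective [] b _ _ b<m = fromℕ< b<m , refl , FinP.toℕ-fromℕ< b<m

quotientOrder-inner : ∀ l n k → let d = suc (suc l) in
  QuotientOrder d (suc (suc n Nat.+ k)) (suc n) (Subtree.repunit (suc l) (suc (suc k)) ^ ((l Nat.* d) Nat.* suc l ^ n))
quotientOrder-inner l n k =
  Coordinates.quotientOrder l child-label< child-labels pos lab
    (λ i → cong suc (word-length n _)) (λ i → FinP.toℕ<n _ , word-labels n _) (λ i → FinP.toℕ<n _)
    enum-injective enum-surjective
  where
  open Level (suc l) (suc n) k
  open Words (suc l)
  split : Fin ((l Nat.* d) Nat.* suc l ^ n) → Fin (l Nat.* d) × Fin (suc l ^ n)
  split = Fin.remQuot {l Nat.* d} (suc l ^ n)
  pos : Fin ((l Nat.* d) Nat.* suc l ^ n) → List ℕ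
  pos i = toℕ (Fin.remainder {l} d (proj₁ (split i))) ∷ word n (proj₂ (split i))
  lab : Fin ((l Nat.* d) Nat.* suc l ^ n) → ℕ
  lab i = toℕ (Fin.quotient {l} d (proj₁ (split i)))
  child-label< : ∀ v b → length v ≡ suc n → Labels d (v ∷ʳ b) → b < suc l
  child-label< (y ∷ v) b _ (_ , all<) with AllP.++⁻ʳ v all<
  ... | b<m ∷ [] = b<m
  child-labels : ∀ v b → length v ≡ suc n → Labels d v → b < suc l → Labels d (v ∷ʳ b)
  child-labels (y ∷ v) b _ (y<d , all<) b<m = y<d , AllP.++⁺ all< (b<m ∷ [])
  enum-injective : ∀ {i j} → pos i ≡ pos j → lab i ≡ lab j → i ≡ j
  enum-injective pos≡ lab≡ = remQuot-injective {l Nat.* d} (suc l ^ n)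
    (remQuot-injective {l} d (FinP.toℕ-injective lab≡) (FinP.toℕ-injective (ListP.∷-injectiveˡ pos≡)))
    (word-injective n (ListP.∷-injectiveʳ pos≡))
  enum-surjective : ∀ v b → length v ≡ suc n → Labels d v → b < l → ∃ λ i → pos i ≡ v × lab i ≡ b
  enum-surjective (y ∷ v) b v≡n (y<d , v<m) b<l with word-surjective n v (ℕP.suc-injective v≡n) v<m
  ... | w , word≡v = combine x w ,
    cong₂ _∷_ (trans (cong (toℕ ∘ Fin.remainder {l} d ∘ proj₁) outer)
                     (trans (cong (toℕ ∘ proj₂) inner) (FinP.toℕ-fromℕ< y<d)))
              (trans (cong (word n ∘ proj₂) outer) word≡v) ,
    trans (cong (toℕ ∘ Fin.quotient {l} d ∘ proj₁) outer)
          (trans (cong (toℕ ∘ proj₁) inner) (FinP.toℕ-fromℕ< b<l))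
    where
    x = combine {l} {d} (fromℕ< b<l) (fromℕ< y<d)
    outer = FinP.remQuot-combine {l Nat.* d} {suc l ^ n} x w
    inner = FinP.remQuot-combine {l} {d} (fromℕ< b<l) (fromℕ< y<d)

θ≡repunit : ∀ e r → θ (suc (suc (suc e))) r ≡ Subtree.repunit (suc (suc e)) r
θ≡repunit e r = trans (cong (λ x → (x ∸ 1) Nat./ suc e) (power≡ r)) (ℕDivMod.m*n/n≡m (repunit r) (suc e))
  where
  open Subtree (suc (suc e)) using (repunit)
  power≡ : ∀ r → suc (suc e) ^ r ≡ suc (repunit r Nat.* suc e)
  power≡ zero = refl
  power≡ (suc r) = trans (cong (suc (suc e) Nat.*_) (power≡ r)) (expand e (repunit r))
    where
    open Nat using (_+_; _*_)
    expand : ∀ e t → (2 + e) * (1 + t * (1 + e)) ≡ 1 + (1 + t * (2 + e)) * (1 + e)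
    expand = ℕSolver.solve-∀

open import Data.Nat using (ℕ; _≤_; _<_; _∸_; _^_; _*_; _+_)

lemma8p17 : (d h n : ℕ) → 3 ≤ d → 1 ≤ h → n < h →
    (n ≡ 0 → QuotientOrder d h n (θ d (h + 1) ^ (d ∸ 1))) ×
    (1 ≤ n → QuotientOrder d h n (θ d (h + 1 ∸ n) ^ ((d ∸ 2) * d * (d ∸ 1) ^ (n ∸ 1))))
lemma8p17 (suc (suc (suc e))) h n _ _ n<h with h ∸ suc n | ℕP.m+[n∸m]≡n n<h
... | k | refl = root n , inner n
  where
  d = suc (suc (suc e))
  root : ∀ n → n ≡ 0 → QuotientOrder d (suc n + k) n (θ d (suc n + k + 1) ^ (d ∸ 1))
  root .0 refl = subst (λ t → QuotientOrder d (suc k) 0 (t ^ (d ∸ 1)))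
    (sym (trans (cong (θ d) (ℕP.+-comm (suc k) 1)) (θ≡repunit e (suc (suc k)))))
    (quotientOrder-root (suc (suc e)) k)
  inner : ∀ n → 1 ≤ n →
          QuotientOrder d (suc n + k) n (θ d (suc n + k + 1 ∸ n) ^ ((d ∸ 2) * d * (d ∸ 1) ^ (n ∸ 1)))
  inner (suc n) _ = subst (λ t → QuotientOrder d (suc (suc n) + k) (suc n) (t ^ ((d ∸ 2) * d * (d ∸ 1) ^ n)))
    (sym (trans (cong (θ d) height) (θ≡repunit e (suc (suc k)))))
    (quotientOrder-inner (suc e) n k)
    where
    height : suc (suc n) + k + 1 ∸ suc n ≡ suc (suc k)
    height = trans (cong (_∸ suc n) (rearrange n k)) (ℕP.m+n∸m≡n (suc n) (suc (suc k)))
      where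
      rearrange : ∀ n k → 2 + n + k + 1 ≡ (1 + n) + (2 + k)
      rearrange = ℕSolver.solve-∀
lemma8p17 (suc zero) _ _ (s≤s ()) _ _
lemma8p17 (suc (suc zero)) _ _ (s≤s (s≤s ())) _ _
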